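{- Let $G$ and $H$ be finite digraphs. Then either $FF(G,H)$ is finite or $FF(G,H)=\mathbb{N}$. In the latter case, there exists a $\mathbb{Z}$-flow-continuous mapping $E(G)\to E(H)$.
   Context: Digraphs are finite multidigraphs; loops and parallel edges are allowed. For an abelian group $M$, a map $\varphi:E(G)\to M$ is an $M$-flow if at every vertex $v$ the sum of $\varphi$ over edges leaving $v$ equals the sum of $\varphi$ over edges entering $v$. A mapping $f:E(G)\to E(H)$ is $M$-flow-continuous if for every $M$-flow $\varphi$ on $H$ the composition $\varphi\circ f$ is an $M$-flow on $G$. We set $FF(G,H)=\{n\ge 1: \text{there is a } \mathbb{Z}_n\text{ -flow-continuous mapping } E(G)\to E(H)\}$ and $\mathbb{N}=\{1,2,3,\dots\}$. -}

module Defs where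

open import Data.Nat using (ℕ; zero; suc; _≤_)
open import Data.Fin using (Fin; zero; suc; _≟_)
open import Data.Integer as ℤ using (ℤ; +_; _-_; 0ℤ)
open import Data.Integer.Divisibility using (_∣_)
open import Data.Product using (Σ; ∃; _×_)
open import Data.Sum using (_⊎_)
open import Relation.Nullary using (does)
open import Data.Bool using (if_then_else_)
open import Relation.Binary.PropositionalEquality using (_≡_)

-- A finite multidigraph: finitely many vertices and edges, each edge having
-- a tail (source) and a head (target). Loops and parallel edges are allowed.
record Digraph : Set where
  field
    nV   : ℕ
    nE   : ℕ
    tail : Fin nE → Fin nV
    head : Fin nE → Fin nV
open Digraph public

V : Digraph → Set
V G = Fin (nV G)

E : Digraph → Set
E G = Fin (nE G)

Σℤ : (m : ℕ) → (Fin m → ℤ) → ℤ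
Σℤ zero    g = 0ℤ
Σℤ (suc m) g = g zero ℤ.+ Σℤ m (λ i → g (suc i))

net : (G : Digraph) → (E G → ℤ) → V G → ℤ
net G φ v =
  Σℤ (nE G) (λ e → if does (tail G e ≟ v) then φ e else 0ℤ)
  - Σℤ (nE G) (λ e → if does (head G e ≟ v) then φ e else 0ℤ)

IsℤFlow : (G : Digraph) → (E G → ℤ) → Set
IsℤFlow G φ = ∀ v → net G φ v ≡ 0ℤ

-- ℤ_n-flow, with ℤ_n-values represented by integer representatives:
-- the Kirchhoff condition holds modulo n.
IsZnFlow : ℕ → (G : Digraph) → (E G → ℤ) → Set
IsZnFlow n G φ = ∀ v → (+ n) ∣ net G φ v

ZnFlowContinuous : ℕ → (G H : Digraph) → (E G → E H) → Set
ZnFlowContinuous n G H f =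
  ∀ (φ : E H → ℤ) → IsZnFlow n H φ → IsZnFlow n G (λ e → φ (f e))

ℤFlowContinuous : (G H : Digraph) → (E G → E H) → Set
ℤFlowContinuous G H f =
  ∀ (φ : E H → ℤ) → IsℤFlow H φ → IsℤFlow G (λ e → φ (f e))

-- n ∈ FF(G,H)  (n ≥ 1 is imposed where FF is used)
InFF : (G H : Digraph) → ℕ → Set
InFF G H n = Σ (E G → E H) (ZnFlowContinuous n G H)

FFFinite : (G H : Digraph) → Set
FFFinite G H = ∃ λ B → ∀ n → 1 ≤ n → InFF G H n → n ≤ B

-- FF(G,H) = ℕ = {1,2,3,...}
FFAll : (G H : Digraph) → Set
FFAll G H = ∀ n → 1 ≤ n → InFF G H n

module Submission where

-- Fix f : E(G) → E(H). Each vertex v of G gives a linear functional L_v φ = net_G (φ ∘ f) v on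
-- ℤ^E(H). Choose a spanning forest of H, with tree paths P_u from each vertex u to its root and
-- fundamental cycles C_e; then every φ equals Σ_e φ(e) C_e + Σ_u (∂φ)(u) P_u. If every L_v
-- vanishes on every C_e, this gives L_v φ = Σ_u (∂φ)(u) L_v(P_u), so f is ℤ-flow-continuous and
-- ℤ_n-flow-continuous for every n. Otherwise L_v(C_e) = c ≠ 0 for some v and e, and as C_e is a
-- ℤ-flow every n for which f is ℤ_n-flow-continuous divides c. Since there are finitely many maps
-- f, either one of them is of the first kind or FF(G,H) is bounded by the largest such |c|.

open import Defs
open import Data.Bool using (true; false; if_then_else_)
open import Data.Fin using (Fin; zero; suc; _≟_)
open import Data.Fin.Properties using (all?; ¬∀⟶∃¬)
open import Data.Integer as ℤ using (ℤ; 0ℤ; 1ℤ; -1ℤ; _+_; _*_; _-_; ∣_∣)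
import Data.Integer.Divisibility as ℤD
import Data.Integer.Divisibility.Signed as ℤS
import Data.Integer.Properties as ℤP
open import Data.Integer.Tactic.RingSolver using (solve-∀)
open import Data.Nat as ℕ using (ℕ; zero; suc)
import Data.Nat.Divisibility as ℕD
import Data.Nat.Properties as ℕP
open import Data.Product using (Σ; ∃; _×_; _,_)
open import Data.Sum using (_⊎_; inj₁; inj₂)
open import Data.Vec.Functional using (_∷_)
open import Function using (_∘_)
open import Relation.Nullary using (Dec; does; yes; no; contradiction)
open import Relation.Nullary.Decidable using (dec-true; dec-false)
open import Relation.Binary.PropositionalEquality

open import Algebra.Properties.Ring ℤP.+-*-ring using (-1*x≈-x; x[y-z]≈xy-xz; [y-z]x≈yx-zx)
open import Algebra.Properties.Semiring.Sum ℤP.+-*-semiring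
open ≡-Reasoning

∑-distrib-- : ∀ {m} (f g : Fin m → ℤ) → ∑[ i < m ] (f i - g i) ≡ sum f - sum g
∑-distrib-- {zero}  f g = refl
∑-distrib-- {suc m} f g =
  trans (cong ((f zero - g zero) +_) (∑-distrib-- (λ i → f (suc i)) (λ i → g (suc i))))
        (interchange (f zero) (g zero) _ _)
  where
  interchange : ∀ a b c d → (a - b) + (c - d) ≡ (a + c) - (b + d)
  interchange = solve-∀

∑-vanishing : ∀ {m} {g : Fin m → ℤ} → (∀ i → g i ≡ 0ℤ) → sum g ≡ 0ℤ
∑-vanishing {m} g≡0 = trans (sum-cong-≗ g≡0) (sum-replicate-zero m)

∣-∑ : ∀ {m} d (a b : Fin m → ℤ) → (∀ i → d ℤS.∣ a i) → d ℤS.∣ ∑[ i < m ] (a i * b i)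
∣-∑ {zero}  d a b d∣a = ℤS.divides 0ℤ (sym (ℤP.*-zeroˡ d))
∣-∑ {suc m} d a b d∣a = ℤS.∣m∣n⇒∣m+n (ℤS.∣m⇒∣m*n (b zero) (d∣a zero))
                                     (∣-∑ d (λ i → a (suc i)) (λ i → b (suc i)) (λ i → d∣a (suc i)))

δ : ∀ {k} → Fin k → Fin k → ℤ
δ a w = if does (a ≟ w) then 1ℤ else 0ℤ

δ-comm : ∀ {k} (a b : Fin k) → δ a b ≡ δ b a
δ-comm a b with a ≟ b | b ≟ a
... | yes _   | yes _   = refl
... | no _    | no _    = refl
... | yes a≡b | no b≢a  = contradiction (sym a≡b) b≢a
... | no a≢b  | yes b≡a = contradiction (sym b≡a) a≢b

∑-δ : ∀ {k} (a : Fin k) (p : Fin k → ℤ) → ∑[ w < k ] (p w * δ a w) ≡ p a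
∑-δ {suc k} zero p = begin
  p zero * 1ℤ + ∑[ w < k ] (p (suc w) * 0ℤ)
    ≡⟨ cong₂ _+_ (ℤP.*-identityʳ (p zero)) (∑-vanishing (λ w → ℤP.*-zeroʳ (p (suc w)))) ⟩
  p zero + 0ℤ
    ≡⟨ ℤP.+-identityʳ (p zero) ⟩
  p zero
    ∎
∑-δ {suc k} (suc a) p = begin
  p zero * 0ℤ + ∑[ w < k ] (p (suc w) * δ a w)
    ≡⟨ cong₂ _+_ (ℤP.*-zeroʳ (p zero)) (∑-δ a (λ w → p (suc w))) ⟩
  0ℤ + p (suc a)
    ≡⟨ ℤP.+-identityˡ (p (suc a)) ⟩
  p (suc a)
    ∎

record IsLinear {m} (L : (Fin m → ℤ) → ℤ) : Set where
  field
    ≗-cong : ∀ {φ ψ} → φ ≗ ψ → L φ ≡ L ψ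
    +-homo : ∀ φ ψ → L (λ e → φ e + ψ e) ≡ L φ + L ψ
    *-homo : ∀ x φ → L (λ e → x * φ e) ≡ x * L φ

  0-homo : L (λ _ → 0ℤ) ≡ 0ℤ
  0-homo = begin
    L (λ _ → 0ℤ)        ≡⟨ ≗-cong (λ _ → sym (ℤP.*-zeroˡ 0ℤ)) ⟩
    L (λ _ → 0ℤ * 0ℤ)   ≡⟨ *-homo 0ℤ (λ _ → 0ℤ) ⟩
    0ℤ * L (λ _ → 0ℤ)   ≡⟨ ℤP.*-zeroˡ (L (λ _ → 0ℤ)) ⟩
    0ℤ                  ∎

  ∑-homo : ∀ {n} (a : Fin n → ℤ) (X : Fin n → Fin m → ℤ) →
           L (λ e → ∑[ i < n ] (a i * X i e)) ≡ ∑[ i < n ] (a i * L (X i))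
  ∑-homo {zero}  a X = 0-homo
  ∑-homo {suc n} a X = begin
    L (λ e → a zero * X zero e + ∑[ i < n ] (a (suc i) * X (suc i) e))
      ≡⟨ +-homo _ _ ⟩
    L (λ e → a zero * X zero e) + L (λ e → ∑[ i < n ] (a (suc i) * X (suc i) e))
      ≡⟨ cong₂ _+_ (*-homo (a zero) (X zero)) (∑-homo (λ i → a (suc i)) (λ i → X (suc i))) ⟩
    a zero * L (X zero) + ∑[ i < n ] (a (suc i) * L (X (suc i)))
      ∎

  sub-homo : ∀ φ ψ → L (λ e → φ e - ψ e) ≡ L φ - L ψ
  sub-homo φ ψ = begin
    L (λ e → φ e - ψ e)          ≡⟨ ≗-cong (λ e → cong (φ e +_) (sym (-1*x≈-x (ψ e)))) ⟩
    L (λ e → φ e + -1ℤ * ψ e)    ≡⟨ +-homo φ (λ e → -1ℤ * ψ e) ⟩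
    L φ + L (λ e → -1ℤ * ψ e)    ≡⟨ cong (L φ +_) (trans (*-homo -1ℤ ψ) (-1*x≈-x (L ψ))) ⟩
    L φ - L ψ                    ∎

dot : ∀ {m} → (Fin m → ℤ) → (Fin m → ℤ) → ℤ
dot {m} c φ = ∑[ e < m ] (c e * φ e)

dot-linear : ∀ {m} (c : Fin m → ℤ) → IsLinear (dot c)
dot-linear {m} c = record
  { ≗-cong = λ φ≗ψ → sum-cong-≗ (λ e → cong (c e *_) (φ≗ψ e))
  ; +-homo = λ φ ψ → trans (sum-cong-≗ (λ e → ℤP.*-distribˡ-+ (c e) (φ e) (ψ e)))
                           (∑-distrib-+ (λ e → c e * φ e) (λ e → c e * ψ e))
  ; *-homo = λ x φ → trans (sum-cong-≗ (λ e → swap-scalar (c e) x (φ e)))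
                           (sym (*-distribˡ-sum x (λ e → c e * φ e)))
  }
  where
  swap-scalar : ∀ a x b → a * (x * b) ≡ x * (a * b)
  swap-scalar = solve-∀

∘-linear : ∀ {m n} {L : (Fin n → ℤ) → ℤ} → IsLinear L → (f : Fin n → Fin m) →
           IsLinear (λ (φ : Fin m → ℤ) → L (λ e → φ (f e)))
∘-linear lin f = record
  { ≗-cong = λ φ≗ψ → ≗-cong (λ e → φ≗ψ (f e))
  ; +-homo = λ φ ψ → +-homo (λ e → φ (f e)) (λ e → ψ (f e))
  ; *-homo = λ x φ → *-homo x (λ e → φ (f e))
  }
  where open IsLinear lin

incidence : ∀ {k m} (t h : Fin m → Fin k) → Fin k → Fin m → ℤ
incidence t h w e = δ (t e) w - δ (h e) w

∂ : ∀ {k m} (t h : Fin m → Fin k) → (Fin m → ℤ) → Fin k → ℤ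
∂ t h φ w = dot (incidence t h w) φ

module _ {k m} (t h : Fin m → Fin k) where

  ∂-linear : ∀ w → IsLinear (λ φ → ∂ t h φ w)
  ∂-linear w = dot-linear (incidence t h w)

  ∂-δ : ∀ e w → ∂ t h (δ e) w ≡ incidence t h w e
  ∂-δ e w = ∑-δ e (incidence t h w)

  ∑-incidence : ∀ (p : Fin k → ℤ) e → ∑[ w < k ] (p w * incidence t h w e) ≡ p (t e) - p (h e)
  ∑-incidence p e = begin
    ∑[ w < k ] (p w * (δ (t e) w - δ (h e) w))
      ≡⟨ sum-cong-≗ (λ w → x[y-z]≈xy-xz (p w) (δ (t e) w) (δ (h e) w)) ⟩
    ∑[ w < k ] (p w * δ (t e) w - p w * δ (h e) w)
      ≡⟨ ∑-distrib-- (λ w → p w * δ (t e) w) (λ w → p w * δ (h e) w) ⟩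
    ∑[ w < k ] (p w * δ (t e) w) - ∑[ w < k ] (p w * δ (h e) w)
      ≡⟨ cong₂ _-_ (∑-δ (t e) p) (∑-δ (h e) p) ⟩
    p (t e) - p (h e)
      ∎

  ∂-adjoint : ∀ φ (p : Fin k → ℤ) →
              ∑[ w < k ] (∂ t h φ w * p w) ≡ ∑[ e < m ] (φ e * (p (t e) - p (h e)))
  ∂-adjoint φ p = begin
    ∑[ w < k ] (∂ t h φ w * p w)
      ≡⟨ sum-cong-≗ (λ w → ℤP.*-comm (∂ t h φ w) (p w)) ⟩
    ∑[ w < k ] (p w * ∑[ e < m ] (incidence t h w e * φ e))
      ≡⟨ sum-cong-≗ (λ w → *-distribˡ-sum (p w) (λ e → incidence t h w e * φ e)) ⟩
    ∑[ w < k ] ∑[ e < m ] (p w * (incidence t h w e * φ e))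
      ≡⟨ ∑-comm (λ w e → p w * (incidence t h w e * φ e)) ⟩
    ∑[ e < m ] ∑[ w < k ] (p w * (incidence t h w e * φ e))
      ≡⟨ sum-cong-≗ (λ e → trans (sum-cong-≗ (λ w → sym (ℤP.*-assoc (p w) _ (φ e))))
                                 (sym (*-distribʳ-sum (φ e) (λ w → p w * incidence t h w e)))) ⟩
    ∑[ e < m ] (∑[ w < k ] (p w * incidence t h w e) * φ e)
      ≡⟨ sum-cong-≗ (λ e → trans (cong (_* φ e) (∑-incidence p e)) (ℤP.*-comm _ (φ e))) ⟩
    ∑[ e < m ] (φ e * (p (t e) - p (h e)))
      ∎

Σℤ≡sum : ∀ m (g : Fin m → ℤ) → Σℤ m g ≡ sum g
Σℤ≡sum zero    g = refl
Σℤ≡sum (suc m) g = cong (g zero +_) (Σℤ≡sum m (λ i → g (suc i)))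

select≡δ* : ∀ {k} (a w : Fin k) x → (if does (a ≟ w) then x else 0ℤ) ≡ δ a w * x
select≡δ* a w x with does (a ≟ w)
... | true  = sym (ℤP.*-identityˡ x)
... | false = sym (ℤP.*-zeroˡ x)

net≡∂ : (G : Digraph) (φ : E G → ℤ) (v : V G) → net G φ v ≡ ∂ (tail G) (head G) φ v
net≡∂ G φ v = begin
  net G φ v
    ≡⟨ cong₂ _-_ (selection (tail G)) (selection (head G)) ⟩
  ∑[ e < nE G ] (δ (tail G e) v * φ e) - ∑[ e < nE G ] (δ (head G e) v * φ e)
    ≡⟨ sym (∑-distrib-- (λ e → δ (tail G e) v * φ e) (λ e → δ (head G e) v * φ e)) ⟩
  ∑[ e < nE G ] (δ (tail G e) v * φ e - δ (head G e) v * φ e)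
    ≡⟨ sum-cong-≗ (λ e → sym ([y-z]x≈yx-zx (φ e) (δ (tail G e) v) (δ (head G e) v))) ⟩
  ∂ (tail G) (head G) φ v
    ∎
  where
  selection : (end : E G → V G) →
    Σℤ (nE G) (λ e → if does (end e ≟ v) then φ e else 0ℤ) ≡ ∑[ e < nE G ] (δ (end e) v * φ e)
  selection end = trans (Σℤ≡sum (nE G) _) (sum-cong-≗ (λ e → select≡δ* (end e) v (φ e)))

net-cong : (G : Digraph) {φ ψ : E G → ℤ} → φ ≗ ψ → ∀ v → net G φ v ≡ net G ψ v
net-cong G {φ} {ψ} φ≗ψ v =
  trans (net≡∂ G φ v)
        (trans (IsLinear.≗-cong (∂-linear (tail G) (head G) v) φ≗ψ) (sym (net≡∂ G ψ v)))

-- A spanning forest of the digraph with tail map t and head map h: root u is the root of the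
-- tree containing u, and path u is the unit flow along the tree path from u to root u.
record PathSystem {k m} (t h : Fin m → Fin k) : Set where
  field
    root      : Fin k → Fin k
    root-edge : ∀ e → root (t e) ≡ root (h e)
    path      : Fin k → Fin m → ℤ
    ∂-path    : ∀ u w → ∂ t h (path u) w ≡ δ u w - δ (root u) w

module _ {k m} (t h : Fin (suc m) → Fin k) where

  private
    t′ h′ : Fin m → Fin k
    t′ e = t (suc e)
    h′ e = h (suc e)
    a b : Fin k
    a = t zero
    b = h zero

  ∂-0∷ : ∀ ψ w → ∂ t h (0ℤ ∷ ψ) w ≡ ∂ t′ h′ ψ w
  ∂-0∷ ψ w = trans (cong (_+ ∂ t′ h′ ψ w) (ℤP.*-zeroʳ (incidence t h w zero))) (ℤP.+-identityˡ _)

  add-edge-inside : (P : PathSystem t′ h′) → PathSystem.root P a ≡ PathSystem.root P b →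
                    PathSystem t h
  add-edge-inside P ra≡rb = record
    { root      = root
    ; root-edge = λ { zero → ra≡rb ; (suc e) → root-edge e }
    ; path      = λ u → 0ℤ ∷ path u
    ; ∂-path    = λ u w → trans (∂-0∷ (path u) w) (∂-path u w)
    }
    where open PathSystem P

  add-edge-between : (P : PathSystem t′ h′) → PathSystem.root P a ≢ PathSystem.root P b →
                     PathSystem t h
  add-edge-between P ra≢rb = record
    { root = root′ ; root-edge = root′-edge ; path = path′ ; ∂-path = ∂-path′ }
    where
    open PathSystem P

    root′ : Fin k → Fin k
    root′ u = if does (root u ≟ root b) then root a else root u

    root′-edge : ∀ e → root′ (t e) ≡ root′ (h e)
    root′-edge zero = begin
      (if does (root a ≟ root b) then root a else root a)
        ≡⟨ cong (if_then root a else root a) (dec-false (root a ≟ root b) ra≢rb) ⟩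
      root a
        ≡⟨ cong (if_then root a else root b) (dec-true (root b ≟ root b) refl) ⟨
      (if does (root b ≟ root b) then root a else root b)
        ∎
    root′-edge (suc e) = cong (λ r → if does (r ≟ root b) then root a else r) (root-edge e)

    -- In the tree of b, the path to the new root a runs to b, back along the new edge, then to a.
    path′ : Fin k → Fin (suc m) → ℤ
    path′ u = if does (root u ≟ root b)
              then -1ℤ ∷ (λ e → path u e - path b e + path a e)
              else 0ℤ ∷ path u

    ∂-path′ : ∀ u w → ∂ t h (path′ u) w ≡ δ u w - δ (root′ u) w
    ∂-path′ u w with root u ≟ root b
    ... | no _      = trans (∂-0∷ (path u) w) (∂-path u w)
    ... | yes ru≡rb = begin
      incidence t h w zero * -1ℤ + ∂ t′ h′ (λ e → path u e - path b e + path a e) w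
        ≡⟨ cong (incidence t h w zero * -1ℤ +_) (trans (+-homo _ (path a))
                  (cong (_+ ∂ t′ h′ (path a) w) (sub-homo (path u) (path b)))) ⟩
      incidence t h w zero * -1ℤ + (∂ t′ h′ (path u) w - ∂ t′ h′ (path b) w + ∂ t′ h′ (path a) w)
        ≡⟨ cong (incidence t h w zero * -1ℤ +_)
                (cong₂ _+_ (cong₂ _-_ ∂-path-u (∂-path b w)) (∂-path a w)) ⟩
      (δ a w - δ b w) * -1ℤ + ((δ u w - δ (root b) w) - (δ b w - δ (root b) w) + (δ a w - δ (root a) w))
        ≡⟨ telescope (δ a w) (δ b w) (δ u w) (δ (root b) w) (δ (root a) w) ⟩
      δ u w - δ (root a) w
        ∎
      where
      open IsLinear (∂-linear t′ h′ w)
      ∂-path-u : ∂ t′ h′ (path u) w ≡ δ u w - δ (root b) w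
      ∂-path-u = trans (∂-path u w) (cong (λ r → δ u w - δ r w) ru≡rb)
      telescope : ∀ A B U Rb Ra → (A - B) * -1ℤ + ((U - Rb) - (B - Rb) + (A - Ra)) ≡ U - Ra
      telescope = solve-∀

pathSystem : ∀ {k} m (t h : Fin m → Fin k) → PathSystem t h
pathSystem zero t h = record
  { root      = λ u → u
  ; root-edge = λ ()
  ; path      = λ _ ()
  ; ∂-path    = λ u w → sym (ℤP.+-inverseʳ (δ u w))
  }
pathSystem (suc m) t h = extend (pathSystem m (λ e → t (suc e)) (λ e → h (suc e)))
  where
  extend : PathSystem (λ e → t (suc e)) (λ e → h (suc e)) → PathSystem t h
  extend P with PathSystem.root P (t zero) ≟ PathSystem.root P (h zero)
  ... | yes ra≡rb = add-edge-inside t h P ra≡rb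
  ... | no ra≢rb  = add-edge-between t h P ra≢rb

module _ {k m} {t h : Fin m → Fin k} (P : PathSystem t h) where
  open PathSystem P

  -- The fundamental cycle of e: the edge e, then the tree paths from h e to the root and back to t e.
  cycle : Fin m → Fin m → ℤ
  cycle e x = δ e x - (path (t e) x - path (h e) x)

  ∂-cycle : ∀ e w → ∂ t h (cycle e) w ≡ 0ℤ
  ∂-cycle e w = begin
    ∂ t h (cycle e) w
      ≡⟨ sub-homo (δ e) (λ x → path (t e) x - path (h e) x) ⟩
    ∂ t h (δ e) w - ∂ t h (λ x → path (t e) x - path (h e) x) w
      ≡⟨ cong₂ _-_ (∂-δ t h e w) (sub-homo (path (t e)) (path (h e))) ⟩
    (δ (t e) w - δ (h e) w) - (∂ t h (path (t e)) w - ∂ t h (path (h e)) w)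
      ≡⟨ cong ((δ (t e) w - δ (h e) w) -_) (cong₂ _-_ (∂-path (t e) w) ∂-path-he) ⟩
    (δ (t e) w - δ (h e) w) - ((δ (t e) w - δ (root (t e)) w) - (δ (h e) w - δ (root (t e)) w))
      ≡⟨ cancel (δ (t e) w) (δ (h e) w) (δ (root (t e)) w) ⟩
    0ℤ
      ∎
    where
    open IsLinear (∂-linear t h w)
    ∂-path-he : ∂ t h (path (h e)) w ≡ δ (h e) w - δ (root (t e)) w
    ∂-path-he = trans (∂-path (h e) w) (cong (λ r → δ (h e) w - δ r w) (sym (root-edge e)))
    cancel : ∀ T H R → (T - H) - ((T - R) - (H - R)) ≡ 0ℤ
    cancel = solve-∀

  decomposition : ∀ φ x → φ x ≡ ∑[ e < m ] (φ e * cycle e x) + ∑[ u < k ] (∂ t h φ u * path u x)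
  decomposition φ x = sym (begin
    ∑[ e < m ] (φ e * cycle e x) + ∑[ u < k ] (∂ t h φ u * path u x)
      ≡⟨ cong (∑[ e < m ] (φ e * cycle e x) +_) (∂-adjoint t h φ (λ u → path u x)) ⟩
    ∑[ e < m ] (φ e * cycle e x) + ∑[ e < m ] (φ e * (path (t e) x - path (h e) x))
      ≡⟨ sym (∑-distrib-+ (λ e → φ e * cycle e x) (λ e → φ e * (path (t e) x - path (h e) x))) ⟩
    ∑[ e < m ] (φ e * cycle e x + φ e * (path (t e) x - path (h e) x))
      ≡⟨ sum-cong-≗ (λ e → trans (recombine (φ e) (δ e x) _) (cong (φ e *_) (δ-comm e x))) ⟩
    ∑[ e < m ] (φ e * δ x e)
      ≡⟨ ∑-δ x φ ⟩
    φ x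
      ∎)
    where
    recombine : ∀ a d q → a * (d - q) + a * q ≡ a * d
    recombine = solve-∀

  factor-through-∂ : ∀ {L} → IsLinear L → (∀ e → L (cycle e) ≡ 0ℤ) →
                     ∀ φ → L φ ≡ ∑[ u < k ] (∂ t h φ u * L (path u))
  factor-through-∂ {L} lin L-cycle≡0 φ = begin
    L φ
      ≡⟨ ≗-cong (decomposition φ) ⟩
    L (λ x → ∑[ e < m ] (φ e * cycle e x) + ∑[ u < k ] (∂ t h φ u * path u x))
      ≡⟨ +-homo _ _ ⟩
    L (λ x → ∑[ e < m ] (φ e * cycle e x)) + L (λ x → ∑[ u < k ] (∂ t h φ u * path u x))
      ≡⟨ cong₂ _+_ (∑-homo φ cycle) (∑-homo (∂ t h φ) path) ⟩
    ∑[ e < m ] (φ e * L (cycle e)) + ∑[ u < k ] (∂ t h φ u * L (path u))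
      ≡⟨ cong (_+ ∑[ u < k ] (∂ t h φ u * L (path u)))
              (∑-vanishing (λ e → trans (cong (φ e *_) (L-cycle≡0 e)) (ℤP.*-zeroʳ (φ e)))) ⟩
    0ℤ + ∑[ u < k ] (∂ t h φ u * L (path u))
      ≡⟨ ℤP.+-identityˡ _ ⟩
    ∑[ u < k ] (∂ t h φ u * L (path u))
      ∎
    where open IsLinear lin

Bounded : (ℕ → Set) → Set
Bounded B = ∃ λ N → ∀ n → B n → n ℕ.≤ N

witness-or-bounded : ∀ k {P : Fin k → Set} {B : Fin k → ℕ → Set} →
  (∀ x → P x ⊎ Bounded (B x)) → ∃ P ⊎ Bounded (λ n → ∃ λ x → B x n)
witness-or-bounded zero    _ = inj₂ (0 , λ { _ (() , _) })
witness-or-bounded (suc k) {P} {B} d = combine (d zero) (witness-or-bounded k (λ x → d (suc x)))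
  where
  combine : P zero ⊎ Bounded (B zero) → ∃ (λ x → P (suc x)) ⊎ Bounded (λ n → ∃ λ x → B (suc x) n) →
            ∃ P ⊎ Bounded (λ n → ∃ λ x → B x n)
  combine (inj₁ p) _                    = inj₁ (zero , p)
  combine (inj₂ _) (inj₁ (x , p))       = inj₁ (suc x , p)
  combine (inj₂ (N₀ , b₀)) (inj₂ (N₁ , b₁)) = inj₂ (N₀ ℕ.⊔ N₁ , λ
    { n (zero , c)  → ℕP.≤-trans (b₀ n c) (ℕP.m≤m⊔n N₀ N₁)
    ; n (suc x , c) → ℕP.≤-trans (b₁ n (x , c)) (ℕP.m≤n⊔m N₀ N₁) })

witness-or-bounded-→ : ∀ m {k} {P : (Fin m → Fin k) → Set} {B : (Fin m → Fin k) → ℕ → Set} →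
  (∀ {f g n} → f ≗ g → B f n → B g n) →
  (∀ f → P f ⊎ Bounded (B f)) → ∃ P ⊎ Bounded (λ n → ∃ λ f → B f n)
witness-or-bounded-→ zero {P = P} {B} B-resp d = only (d λ ())
  where
  only : P (λ ()) ⊎ Bounded (B (λ ())) → ∃ P ⊎ Bounded (λ n → ∃ λ f → B f n)
  only (inj₁ p)       = inj₁ (_ , p)
  only (inj₂ (N , b)) = inj₂ (N , λ n (f , c) → b n (B-resp (λ ()) c))
witness-or-bounded-→ (suc m) {k} {P} {B} B-resp d =
  uncurry (witness-or-bounded k (λ x → witness-or-bounded-→ m (B-resp ∘ ∷-cong x) (λ g → d (x ∷ g))))
  where
  ∷-cong : ∀ x {f g : Fin m → Fin k} → f ≗ g → (x ∷ f) ≗ (x ∷ g)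
  ∷-cong x f≗g zero    = refl
  ∷-cong x f≗g (suc i) = f≗g i
  uncurry : ∃ (λ x → ∃ λ g → P (x ∷ g)) ⊎ Bounded (λ n → ∃ λ x → ∃ λ g → B (x ∷ g) n) →
            ∃ P ⊎ Bounded (λ n → ∃ λ f → B f n)
  uncurry (inj₁ (x , g , p)) = inj₁ (x ∷ g , p)
  uncurry (inj₂ (N , b))     = inj₂ (N , λ n (f , c) →
    b n (f zero , (λ i → f (suc i)) , B-resp (λ { zero → refl ; (suc i) → refl }) c))

module _ (G H : Digraph) where

  ZnFlowContinuous-resp : ∀ {n} {f g : E G → E H} → f ≗ g →
                          ZnFlowContinuous n G H f → ZnFlowContinuous n G H g
  ZnFlowContinuous-resp {n} f≗g f-cont φ φ-Zn v =
    subst (ℤ.+ n ℤD.∣_) (net-cong G (λ e → cong φ (f≗g e)) v) (f-cont φ φ-Zn v)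

  FactorsThroughNet : (E G → E H) → Set
  FactorsThroughNet f =
    ∀ v → Σ (V H → ℤ) λ p → ∀ φ → net G (λ e → φ (f e)) v ≡ ∑[ u < nV H ] (net H φ u * p u)

  factors⇒ℤFlowContinuous : ∀ {f} → FactorsThroughNet f → ℤFlowContinuous G H f
  factors⇒ℤFlowContinuous factors φ φ-flow v with factors v
  ... | p , net≡∑ = trans (net≡∑ φ) (∑-vanishing (λ u → trans (cong (_* p u) (φ-flow u)) (ℤP.*-zeroˡ (p u))))

  factors⇒ZnFlowContinuous : ∀ {f} → FactorsThroughNet f → ∀ n → ZnFlowContinuous n G H f
  factors⇒ZnFlowContinuous factors n φ φ-Zn v with factors v
  ... | p , net≡∑ =
    subst (ℤ.+ n ℤD.∣_) (sym (net≡∑ φ)) (ℤS.∣⇒∣ᵤ (∣-∑ (ℤ.+ n) (net H φ) p (λ u → ℤS.∣ᵤ⇒∣ (φ-Zn u))))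

  nonvanishing⇒bounded : ∀ {f} v φ → IsℤFlow H φ → net G (λ e → φ (f e)) v ≢ 0ℤ →
                         Bounded (λ n → ZnFlowContinuous n G H f)
  nonvanishing⇒bounded {f} v φ φ-flow L≢0 = ∣ L ∣ , λ n Zn-cont →
    ℕD.∣⇒≤ {{ℕ.≢-nonZero (L≢0 ∘ ℤP.∣i∣≡0⇒i≡0)}}
      (Zn-cont φ (λ w → subst (ℤ.+ n ℤD.∣_) (sym (φ-flow w)) (n ℕD.∣0)) v)
    where
    L : ℤ
    L = net G (λ e → φ (f e)) v

  map-dichotomy : (f : E G → E H) → FactorsThroughNet f ⊎ Bounded (λ n → ZnFlowContinuous n G H f)
  map-dichotomy f = dichotomy (all? (λ v → all? (λ e → L v (cycle P e) ℤ.≟ 0ℤ)))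
    where
    P : PathSystem (tail H) (head H)
    P = pathSystem (nE H) (tail H) (head H)
    open PathSystem P

    L : V G → (E H → ℤ) → ℤ
    L v φ = ∂ (tail G) (head G) (λ e → φ (f e)) v

    dichotomy : Dec (∀ v e → L v (cycle P e) ≡ 0ℤ) →
                FactorsThroughNet f ⊎ Bounded (λ n → ZnFlowContinuous n G H f)
    dichotomy (yes vanish) = inj₁ (λ v → (λ u → L v (path u)) , λ φ → begin
      net G (λ e → φ (f e)) v
        ≡⟨ net≡∂ G (λ e → φ (f e)) v ⟩
      L v φ
        ≡⟨ factor-through-∂ P (∘-linear (∂-linear (tail G) (head G) v) f) (vanish v) φ ⟩
      ∑[ u < nV H ] (∂ (tail H) (head H) φ u * L v (path u))
        ≡⟨ sum-cong-≗ (λ u → cong (_* L v (path u)) (sym (net≡∂ H φ u))) ⟩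
      ∑[ u < nV H ] (net H φ u * L v (path u))
        ∎)
    dichotomy (no ¬vanish) =
      let v , ¬vanish-at-v = ¬∀⟶∃¬ (nV G) _ (λ v → all? (λ e → L v (cycle P e) ℤ.≟ 0ℤ)) ¬vanish
          e , L≢0          = ¬∀⟶∃¬ (nE H) _ (λ e → L v (cycle P e) ℤ.≟ 0ℤ) ¬vanish-at-v
      in inj₂ (nonvanishing⇒bounded v (cycle P e)
                 (λ w → trans (net≡∂ H (cycle P e) w) (∂-cycle P e w))
                 (L≢0 ∘ trans (sym (net≡∂ G (λ x → cycle P e (f x)) v))))

lemma2p7 : (G H : Digraph) →
    FFFinite G H ⊎ (FFAll G H × Σ (E G → E H) (ℤFlowContinuous G H))
lemma2p7 G H = conclude (witness-or-bounded-→ (nE G) (ZnFlowContinuous-resp G H) (map-dichotomy G H))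
  where
  conclude : ∃ (FactorsThroughNet G H) ⊎ Bounded (λ n → ∃ λ f → ZnFlowContinuous n G H f) →
             FFFinite G H ⊎ (FFAll G H × Σ (E G → E H) (ℤFlowContinuous G H))
  conclude (inj₁ (f , factors)) =
    inj₂ ((λ n _ → f , factors⇒ZnFlowContinuous G H factors n) , f , factors⇒ℤFlowContinuous G H factors)
  conclude (inj₂ (N , bound)) = inj₁ (N , λ n _ → bound n)
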